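{- Let $\{Q_\alpha\}$ and $\{R_\alpha\}$ be graded bases of $\mathrm{QSym}$ indexed by compositions (with $Q_\alpha,R_\alpha\in\mathrm{QSym}_{|\alpha|}$). Then the following are equivalent: (i) There exists a nonsingular function $f\colon\mathrm{Comp}_{>0}\to\mathbbm{k}$ such that $Q_\alpha=\sum_{\beta\ge\alpha}f(\alpha,\beta)R_\beta$ for all compositions $\alpha$. (ii) There exists a nonsingular function $g\colon\mathrm{Comp}_{>0}\to\mathbbm{k}$ such that $R_\alpha=\sum_{\beta\ge\alpha}g(\alpha,\beta)Q_\beta$ for all compositions $\alpha$.
   Context: $\mathbbm{k}$ is a fixed field. A composition is a finite sequence $\alpha=(\alpha_1,\dots,\alpha_\ell)$ of positive integers; $\ell(\alpha)=\ell$, $|\alpha|=\sum\alpha_i$, $\alpha\vDash n$ means $|\alpha|=n$; $\emptyset$ is the empty composition; $\mathrm{Comp}_{>0}$ is the set of nonempty compositions; a positive integer $n$ is identified with $(n)$. For $|\alpha|=|\beta|$, write $\alpha\le\beta$ if $\alpha$ is a concatenation $\alpha=\alpha^{(1)}\cdots\alpha^{(\ell(\beta))}$ with $\alpha^{(i)}\vDash\beta_i$ for each $i$. For $f\colon\mathrm{Comp}_{>0}\to\mathbbm{k}$ and $\alpha\le\beta$, set $f(\alpha,\beta)=\prod_{i}f(\alpha^{(i)})$, with $f(\emptyset,\emptyset)=1$. A function $f\colon\mathrm{Comp}_{>0}\to\mathbbm{k}$ is nonsingular if $f((n))\ne0$ for all positive integers $n$. $\mathrm{QSym}$ is the algebra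 of quasisymmetric functions over $\mathbbm{k}$, graded by degree, with $\mathrm{QSym}_n$ spanned by the monomial quasisymmetric functions $M_\alpha$, $\alpha\vDash n$. -}

module Defs where

open import Level using (Level; _⊔_)
open import Data.Nat as ℕ using (ℕ; zero; suc)
open import Data.List using (List; []; _∷_; map; concatMap; foldr)
open import Data.List.NonEmpty as List⁺ using (List⁺; _∷_; [_])
open import Data.Product using (Σ; ∃; _×_; _,_)
open import Relation.Nullary using (¬_)
open import Relation.Binary.PropositionalEquality using (_≡_)
open import Algebra.Bundles using (CommutativeRing)

record Field (c ℓ : Level) : Set (Level.suc (c ⊔ ℓ)) where
  field
    commutativeRing : CommutativeRing c ℓ
  open CommutativeRing commutativeRing public
  field
    1≉0     : ¬ (1# ≈ 0#)
    inverse : ∀ x → ¬ (x ≈ 0#) → Σ Carrier (λ y → (x * y) ≈ 1#)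

-- 1+ p  is the positive integer p + 1
data ℕ⁺ : Set where
  1+ : ℕ → ℕ⁺

toℕ : ℕ⁺ → ℕ
toℕ (1+ p) = suc p

_+⁺_ : ℕ⁺ → ℕ⁺ → ℕ⁺
1+ p +⁺ 1+ q = 1+ (suc (p ℕ.+ q))

Comp : Set
Comp = List ℕ⁺

-- A nonempty composition (element of Comp_{>0})
Comp⁺ : Set
Comp⁺ = List⁺ ℕ⁺

size : Comp → ℕ
size α = foldr (λ a n → toℕ a ℕ.+ n) 0 α

size⁺ : Comp⁺ → ℕ⁺
size⁺ (a ∷ α) = go a α
  where
    go : ℕ⁺ → Comp → ℕ⁺
    go x []       = x
    go x (y ∷ ys) = x +⁺ go y ys

-- all compositions of n+1, by induction on n: each composition of n+2
-- arises uniquely from a composition of n+1 by either prepending a part 1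
-- or increasing the first part by 1
private
  incFirst : Comp → Comp
  incFirst []           = []
  incFirst (1+ p ∷ α)   = 1+ (suc p) ∷ α

compsSuc : ℕ → List Comp
compsSuc zero    = (1+ 0 ∷ []) ∷ []
compsSuc (suc n) = concatMap (λ α → (1+ 0 ∷ α) ∷ incFirst α ∷ []) (compsSuc n)

comps : ℕ → List Comp
comps zero    = [] ∷ []
comps (suc n) = compsSuc n

-- Coarsenings.  β ≥ α iff α = α⁽¹⁾ ⋯ α⁽ℓ⁾ with α⁽ⁱ⁾ ⊨ β_i.  Such β
-- correspond bijectively to the ways of cutting α into consecutive
-- nonempty blocks α⁽¹⁾,…,α⁽ℓ⁾ (then β_i = |α⁽ⁱ⁾|).  `cuts α` lists all
-- these block decompositions, each exactly once.

cuts : Comp → List (List Comp⁺)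
cuts []      = [] ∷ []
cuts (a ∷ α) = concatMap (λ bs → ([ a ] ∷ bs) ∷ merge bs) (cuts α)
  where
    merge : List Comp⁺ → List (List Comp⁺)
    merge []       = []
    merge (b ∷ bs) = ((a List⁺.∷⁺ b) ∷ bs) ∷ []

coarsening : List Comp⁺ → Comp
coarsening bs = map size⁺ bs

module _ {c ℓ} (K : Field c ℓ) where
  open Field K

  Σ-list : ∀ {A : Set} → List A → (A → Carrier) → Carrier
  Σ-list xs g = foldr (λ x s → g x + s) 0# xs

  Π-list : ∀ {A : Set} → List A → (A → Carrier) → Carrier
  Π-list xs g = foldr (λ x s → g x * s) 1# xs

  -- f(α,β) = ∏ᵢ f(α⁽ⁱ⁾) for the block decomposition of α over β
  relCoeff : (Comp⁺ → Carrier) → List Comp⁺ → Carrier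
  relCoeff f bs = Π-list bs f

  Nonsingular : (Comp⁺ → Carrier) → Set ℓ
  Nonsingular f = ∀ (n : ℕ⁺) → ¬ (f [ n ] ≈ 0#)

  -- A family  F : Comp → QSym  with F α ∈ QSym_{|α|} is given by its
  -- coordinates in the monomial basis:  F α = Σ_{γ ⊨ |α|} F α γ · M_γ.
  -- (Values F α γ with |γ| ≠ |α| are irrelevant and never used.)
  QSymFamily : Set c
  QSymFamily = Comp → Comp → Carrier

  record IsGradedBasis (F : QSymFamily) : Set (c ⊔ ℓ) where
    field
      spans : ∀ (n : ℕ) (v : Comp → Carrier) →
        ∃ λ (a : Comp → Carrier) →
          ∀ γ → size γ ≡ n → v γ ≈ Σ-list (comps n) (λ α → a α * F α γ)
      independent : ∀ (n : ℕ) (a : Comp → Carrier) →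
        (∀ γ → size γ ≡ n → Σ-list (comps n) (λ α → a α * F α γ) ≈ 0#) →
        ∀ α → size α ≡ n → a α ≈ 0#

  Expands : (Comp⁺ → Carrier) → QSymFamily → QSymFamily → Set ℓ
  Expands f Q R = ∀ (α γ : Comp) → size γ ≡ size α →
    Q α γ ≈ Σ-list (cuts α) (λ bs → relCoeff f bs * R (coarsening bs) γ)

-- Write expand w F α for Σ_{β ≥ α} w(α,β) F β.  Cutting a decomposition of α
-- after its first block shows that expand w is a substitution of words: it is
-- multiplicative for the concatenation product ⊛.  Consequently expanding
-- along f and then along g is expanding along the convolution g ⋆ f, and δ is
-- its unit.  Since (g ⋆ f) q = g q · f(|q|) + (terms in g on strictly shorter
-- compositions), a nonsingular f has a ⋆-inverse g, built by recursion on the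
-- length; then Q = expand f R gives R = expand g Q.
module Submission where

open import Defs
open import Level using (Level)
open import Algebra.Bundles using (CommutativeRing)
open import Data.Nat as ℕ using (ℕ; zero; suc; _≤_; _<_)
open import Data.Nat.Properties as ℕ using ()
open import Data.List using (List; []; _∷_; _++_; map; concatMap; length; foldr)
open import Data.List.Properties using (length-++-≤ˡ; length-++-≤ʳ; map-++)
open import Data.List.NonEmpty as List⁺ using (_∷_; [_]; _∷⁺_)
open import Data.List.Relation.Unary.All as All using (All; []; _∷_)
open import Data.List.Relation.Unary.All.Properties as All using ()
open import Data.Product as Product using (∃; _×_; _,_; proj₁; proj₂)
open import Function using (_∘_)
open import Function.Bundles using (_⇔_; mk⇔)
open import Relation.Binary.PropositionalEquality as ≡ using (_≡_)

toℕ-injective : ∀ {m n} → toℕ m ≡ toℕ n → m ≡ n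
toℕ-injective {1+ p} {1+ q} eq = ≡.cong 1+ (ℕ.suc-injective eq)

toℕ-+⁺ : ∀ m n → toℕ (m +⁺ n) ≡ toℕ m ℕ.+ toℕ n
toℕ-+⁺ (1+ p) (1+ q) = ≡.cong suc (≡.sym (ℕ.+-suc p q))

toℕ-size⁺ : ∀ a u → toℕ (size⁺ (a ∷ u)) ≡ toℕ a ℕ.+ size u
toℕ-size⁺ a []      = ≡.sym (ℕ.+-identityʳ (toℕ a))
toℕ-size⁺ a (b ∷ u) = ≡.trans (toℕ-+⁺ a (size⁺ (b ∷ u))) (≡.cong (toℕ a ℕ.+_) (toℕ-size⁺ b u))

size-++ : ∀ u v → size (u ++ v) ≡ size u ℕ.+ size v
size-++ []      v = ≡.refl
size-++ (a ∷ u) v =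
  ≡.trans (≡.cong (toℕ a ℕ.+_) (size-++ u v)) (≡.sym (ℕ.+-assoc (toℕ a) (size u) (size v)))

infixl 6 _⊕_

_⊕_ : ℕ⁺ → ℕ → ℕ⁺
1+ p ⊕ m = 1+ (p ℕ.+ m)

toℕ-⊕ : ∀ n m → toℕ (n ⊕ m) ≡ toℕ n ℕ.+ m
toℕ-⊕ (1+ p) m = ≡.refl

toℕ-size⁺-++ : ∀ a u v → toℕ (size⁺ (a ∷ u)) ℕ.+ size v ≡ toℕ a ℕ.+ size (u ++ v)
toℕ-size⁺-++ a u v = begin
  toℕ (size⁺ (a ∷ u)) ℕ.+ size v     ≡⟨ ≡.cong (ℕ._+ size v) (toℕ-size⁺ a u) ⟩
  toℕ a ℕ.+ size u ℕ.+ size v        ≡⟨ ℕ.+-assoc (toℕ a) (size u) (size v) ⟩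
  toℕ a ℕ.+ (size u ℕ.+ size v)      ≡⟨ ≡.cong (toℕ a ℕ.+_) (≡.sym (size-++ u v)) ⟩
  toℕ a ℕ.+ size (u ++ v)            ∎
  where open ≡.≡-Reasoning

size⁺-∷-++ : ∀ a u v → size⁺ (a ∷ (u ++ v)) ≡ size⁺ (a ∷ u) ⊕ size v
size⁺-∷-++ a u v = toℕ-injective (begin
  toℕ (size⁺ (a ∷ (u ++ v)))          ≡⟨ toℕ-size⁺ a (u ++ v) ⟩
  toℕ a ℕ.+ size (u ++ v)             ≡⟨ ≡.sym (toℕ-size⁺-++ a u v) ⟩
  toℕ (size⁺ (a ∷ u)) ℕ.+ size v      ≡⟨ ≡.sym (toℕ-⊕ (size⁺ (a ∷ u)) (size v)) ⟩
  toℕ (size⁺ (a ∷ u) ⊕ size v)        ∎)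
  where open ≡.≡-Reasoning

divisions : Comp → List (Comp × Comp)
divisions []      = ([] , []) ∷ []
divisions (b ∷ t) = ([] , b ∷ t) ∷ map (Product.map₁ (b ∷_)) (divisions t)

properDivisions : Comp → List (Comp × Comp)
properDivisions []      = []
properDivisions (b ∷ t) = ([] , b ∷ t) ∷ map (Product.map₁ (b ∷_)) (properDivisions t)

divisions-++ : ∀ t → All (λ (u , v) → u ++ v ≡ t) (divisions t)
divisions-++ []      = ≡.refl ∷ []
divisions-++ (b ∷ t) = ≡.refl ∷ All.map⁺ (All.map (≡.cong (b ∷_)) (divisions-++ t))

divisions-length : ∀ t → All (λ (u , v) → length u ≤ length t × length v ≤ length t) (divisions t)
divisions-length t = All.map (λ {(u , v)} → bounds u v) (divisions-++ t)
  where
    bounds : ∀ u v → u ++ v ≡ t → length u ≤ length t × length v ≤ length t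
    bounds u v ≡.refl = length-++-≤ˡ u , length-++-≤ʳ v {u}

properDivisions-length : ∀ t → All (λ (u , v) → length u < length t × length v ≤ length t) (properDivisions t)
properDivisions-length []      = []
properDivisions-length (b ∷ t) = (ℕ.z<s , ℕ.≤-refl)
  ∷ All.map⁺ (All.map (Product.map ℕ.s<s ℕ.m≤n⇒m≤1+n) (properDivisions-length t))

-- Strong induction on suffixes: the hypothesis covers every suffix of t.
divisions-induction : ∀ {p} (P : Comp → Set p) → P [] →
  (∀ b t → All (P ∘ proj₂) (divisions t) → P (b ∷ t)) → ∀ t → P t
divisions-induction P base step []      = base
divisions-induction P base step (b ∷ t) = step b t (suffixes t)
  where
    suffixes : ∀ t → All (P ∘ proj₂) (divisions t)
    suffixes []      = base ∷ []
    suffixes (b ∷ t) = step b t (suffixes t) ∷ All.map⁺ (suffixes t)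

divisions-last : ∀ t → divisions t ≡ properDivisions t ++ (t , []) ∷ []
divisions-last []      = ≡.refl
divisions-last (b ∷ t) = ≡.cong (([] , b ∷ t) ∷_) (begin
  map (Product.map₁ (b ∷_)) (divisions t)
    ≡⟨ ≡.cong (map _) (divisions-last t) ⟩
  map (Product.map₁ (b ∷_)) (properDivisions t ++ (t , []) ∷ [])
    ≡⟨ map-++ _ (properDivisions t) _ ⟩
  map (Product.map₁ (b ∷_)) (properDivisions t) ++ (b ∷ t , []) ∷ []
    ∎)
  where open ≡.≡-Reasoning

shift : ∀ {a} {A : Set a} → ℕ⁺ → (Comp → A) → Comp → A
shift n F β = F (n ∷ β)

module Expansion {c ℓ} (𝓡 : CommutativeRing c ℓ) where
  open CommutativeRing 𝓡
  open import Relation.Binary.Reasoning.Setoid setoid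
  open import Algebra.Solver.Ring.NaturalCoefficients.Default commutativeSemiring
    using (solve; _:=_; _:+_; _:*_)

  ∑ : {A : Set} → List A → (A → Carrier) → Carrier
  ∑ xs G = foldr (λ x s → G x + s) 0# xs

  ∏ : {A : Set} → List A → (A → Carrier) → Carrier
  ∏ xs G = foldr (λ x s → G x * s) 1# xs

  module _ {A : Set} where

    ∑-congᴬ : ∀ {xs : List A} {G H} → All (λ x → G x ≈ H x) xs → ∑ xs G ≈ ∑ xs H
    ∑-congᴬ []         = refl
    ∑-congᴬ (eq ∷ eqs) = +-cong eq (∑-congᴬ eqs)

    ∑-cong : ∀ (xs : List A) {G H} → (∀ x → G x ≈ H x) → ∑ xs G ≈ ∑ xs H
    ∑-cong []       eq = refl
    ∑-cong (x ∷ xs) eq = +-cong (eq x) (∑-cong xs eq)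

    ∑-map : ∀ {B : Set} (f : A → B) xs G → ∑ (map f xs) G ≡ ∑ xs (G ∘ f)
    ∑-map f []       G = ≡.refl
    ∑-map f (x ∷ xs) G = ≡.cong (G (f x) +_) (∑-map f xs G)

    ∑-++ : ∀ xs ys (G : A → Carrier) → ∑ (xs ++ ys) G ≈ ∑ xs G + ∑ ys G
    ∑-++ []       ys G = sym (+-identityˡ _)
    ∑-++ (x ∷ xs) ys G = trans (+-cong refl (∑-++ xs ys G)) (sym (+-assoc _ _ _))

    ∑-+ : ∀ xs (G H : A → Carrier) → ∑ xs (λ x → G x + H x) ≈ ∑ xs G + ∑ xs H
    ∑-+ []       G H = sym (+-identityˡ 0#)
    ∑-+ (x ∷ xs) G H = trans (+-cong refl (∑-+ xs G H)) (+-interchange _ _ _ _)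
      where
        +-interchange : ∀ a b c d → (a + b) + (c + d) ≈ (a + c) + (b + d)
        +-interchange = solve 4 (λ a b c d → (a :+ b) :+ (c :+ d) := (a :+ c) :+ (b :+ d)) refl

    *-distribˡ-∑ : ∀ a xs (G : A → Carrier) → a * ∑ xs G ≈ ∑ xs (λ x → a * G x)
    *-distribˡ-∑ a []       G = zeroʳ a
    *-distribˡ-∑ a (x ∷ xs) G = trans (distribˡ a _ _) (+-cong refl (*-distribˡ-∑ a xs G))

    *-distribʳ-∑ : ∀ a xs (G : A → Carrier) → ∑ xs G * a ≈ ∑ xs (λ x → G x * a)
    *-distribʳ-∑ a xs G = trans (*-comm _ a) (trans (*-distribˡ-∑ a xs G) (∑-cong xs (λ x → *-comm a (G x))))

  ∑-divisions-assoc : ∀ t (G : Comp → Comp → Comp → Carrier) →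
    ∑ (divisions t) (λ (w , y) → ∑ (divisions w) (λ (u , x) → G u x y)) ≈
    ∑ (divisions t) (λ (u , v) → ∑ (divisions v) (λ (x , y) → G u x y))
  ∑-divisions-assoc []      G = refl
  ∑-divisions-assoc (b ∷ t) G = begin
    (G [] [] (b ∷ t) + 0#) + ∑ (map (Product.map₁ (b ∷_)) (divisions t)) (λ (w , y) → inner G w y)
      ≡⟨ ≡.cong (G [] [] (b ∷ t) + 0# +_) (∑-map _ (divisions t) _) ⟩
    (G [] [] (b ∷ t) + 0#) + ∑ (divisions t) (λ (w , y) → inner G (b ∷ w) y)
      ≈⟨ +-cong refl (∑-cong (divisions t) (λ (w , y) → +-cong refl (reflexive (∑-map _ (divisions w) _)))) ⟩
    (G [] [] (b ∷ t) + 0#) + ∑ (divisions t) (λ (w , y) → G [] (b ∷ w) y + inner G′ w y)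
      ≈⟨ +-cong refl (∑-+ (divisions t) _ _) ⟩
    (G [] [] (b ∷ t) + 0#) + (first + ∑ (divisions t) (λ (w , y) → inner G′ w y))
      ≈⟨ +-cong refl (+-cong refl (∑-divisions-assoc t G′)) ⟩
    (G [] [] (b ∷ t) + 0#) + (first + ∑ (divisions t) (λ (u , v) → ∑ (divisions v) (λ (x , y) → G′ u x y)))
      ≈⟨ trans (+-cong (+-identityʳ _) refl) (sym (+-assoc _ _ _)) ⟩
    (G [] [] (b ∷ t) + first) + ∑ (divisions t) (λ (u , v) → ∑ (divisions v) (λ (x , y) → G′ u x y))
      ≡⟨ ≡.cong₂ (λ p q → (G [] [] (b ∷ t) + p) + q)
                 (≡.sym (∑-map _ (divisions t) _)) (≡.sym (∑-map _ (divisions t) _)) ⟩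
    ∑ (divisions (b ∷ t)) (λ (u , v) → ∑ (divisions v) (λ (x , y) → G u x y))
      ∎
    where
      inner : (Comp → Comp → Comp → Carrier) → Comp → Comp → Carrier
      inner H w y = ∑ (divisions w) (λ (u , x) → H u x y)
      G′ : Comp → Comp → Comp → Carrier
      G′ = G ∘ (b ∷_)
      first : Carrier
      first = ∑ (divisions t) (λ (x , y) → G [] (b ∷ x) y)

  ∑-concatMap : ∀ {A B : Set} (f : A → List B) xs G → ∑ (concatMap f xs) G ≈ ∑ xs (λ x → ∑ (f x) G)
  ∑-concatMap f []       G = refl
  ∑-concatMap f (x ∷ xs) G = trans (∑-++ (f x) (concatMap f xs) G) (+-cong refl (∑-concatMap f xs G))

  merged : (List Comp⁺ → Carrier) → ℕ⁺ → List Comp⁺ → Carrier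
  merged H a []       = 0#
  merged H a (c ∷ cs) = H ((a ∷⁺ c) ∷ cs)

  -- `cuts` merges a new part into the first block by a local function,
  -- which we can only refer to through its defining equations.
  ∑-cuts-∷ : ∀ a α H → ∑ (cuts (a ∷ α)) H ≈ ∑ (cuts α) (λ bs → H ([ a ] ∷ bs) + merged H a bs)
  ∑-cuts-∷ a α H = step _ ≡.refl (λ _ _ → ≡.refl) (cuts α)
    where
      step : ∀ (merge : List Comp⁺ → List (List Comp⁺)) → merge [] ≡ [] →
             (∀ c cs → merge (c ∷ cs) ≡ ((a ∷⁺ c) ∷ cs) ∷ []) → ∀ bss →
             ∑ (concatMap (λ bs → ([ a ] ∷ bs) ∷ merge bs) bss) H ≈
             ∑ bss (λ bs → H ([ a ] ∷ bs) + merged H a bs)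
      step merge merge-[] merge-∷ bss = trans (∑-concatMap _ bss H) (∑-cong bss pointwise)
        where
          pointwise : ∀ bs → ∑ (([ a ] ∷ bs) ∷ merge bs) H ≈ H ([ a ] ∷ bs) + merged H a bs
          pointwise []       rewrite merge-[]     = refl
          pointwise (c ∷ cs) rewrite merge-∷ c cs = +-cong refl (+-identityʳ _)

  ∑-cuts-firstBlock : ∀ a α H →
    ∑ (cuts (a ∷ α)) H ≈ ∑ (divisions α) (λ (u , v) → ∑ (cuts v) (λ bs → H ((a ∷ u) ∷ bs)))
  ∑-cuts-firstBlock a []      H = ∑-cuts-∷ a [] H
  ∑-cuts-firstBlock a (b ∷ α) H = begin
    ∑ (cuts (a ∷ b ∷ α)) H
      ≈⟨ ∑-cuts-∷ a (b ∷ α) H ⟩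
    ∑ (cuts (b ∷ α)) (λ bs → H ([ a ] ∷ bs) + merged H a bs)
      ≈⟨ ∑-+ (cuts (b ∷ α)) _ _ ⟩
    ∑ (cuts (b ∷ α)) (λ bs → H ([ a ] ∷ bs)) + ∑ (cuts (b ∷ α)) (merged H a)
      ≈⟨ +-cong refl (∑-cuts-firstBlock b α (merged H a)) ⟩
    ∑ (cuts (b ∷ α)) (λ bs → H ([ a ] ∷ bs))
      + ∑ (divisions α) (λ (u , v) → ∑ (cuts v) (λ bs → H ((a ∷ b ∷ u) ∷ bs)))
      ≡⟨ ≡.cong (∑ (cuts (b ∷ α)) (λ bs → H ([ a ] ∷ bs)) +_) (≡.sym (∑-map _ (divisions α) _)) ⟩
    ∑ (divisions (b ∷ α)) (λ (u , v) → ∑ (cuts v) (λ bs → H ((a ∷ u) ∷ bs)))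
      ∎

  expand : (Comp⁺ → Carrier) → (Comp → Carrier) → Comp → Carrier
  expand w F α = ∑ (cuts α) (λ bs → ∏ bs w * F (coarsening bs))

  expand-[] : ∀ w F → expand w F [] ≈ F []
  expand-[] w F = trans (+-identityʳ _) (*-identityˡ _)

  expand-∷ : ∀ w F a α → expand w F (a ∷ α) ≈
    ∑ (divisions α) (λ (u , v) → w (a ∷ u) * expand w (shift (size⁺ (a ∷ u)) F) v)
  expand-∷ w F a α = trans (∑-cuts-firstBlock a α _) (∑-cong (divisions α) λ (u , v) →
    trans (∑-cong (cuts v) (λ bs → *-assoc _ _ _)) (sym (*-distribˡ-∑ _ (cuts v) _)))

  expand-congˢ : ∀ w α {F G} → (∀ β → size β ≡ size α → F β ≈ G β) → expand w F α ≈ expand w G α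
  expand-congˢ w = divisions-induction P base step
    where
      P : Comp → Set _
      P α = ∀ {F G} → (∀ β → size β ≡ size α → F β ≈ G β) → expand w F α ≈ expand w G α
      base : P []
      base {F} {G} F≈G = trans (expand-[] w F) (trans (F≈G [] ≡.refl) (sym (expand-[] w G)))
      step : ∀ a t → All (P ∘ proj₂) (divisions t) → P (a ∷ t)
      step a t IH {F} {G} F≈G = trans (expand-∷ w F a t) (trans (∑-congᴬ
        (All.zipWith (λ {(u , v)} (u++v≡t , IHv) → *-cong refl (IHv λ β eq →
            F≈G (size⁺ (a ∷ u) ∷ β) (≡.trans (≡.cong (toℕ (size⁺ (a ∷ u)) ℕ.+_) eq)
              (≡.trans (toℕ-size⁺-++ a u v) (≡.cong (size ∘ (a ∷_)) u++v≡t)))))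
          (divisions-++ t , IH)))
        (sym (expand-∷ w G a t)))

  expand-cong : ∀ w α {F G} → (∀ β → F β ≈ G β) → expand w F α ≈ expand w G α
  expand-cong w α F≈G = expand-congˢ w α (λ β _ → F≈G β)

  expand-local : ∀ α {w w'} F → (∀ q → List⁺.length q ≤ length α → w q ≈ w' q) →
    expand w F α ≈ expand w' F α
  expand-local = divisions-induction P base step
    where
      P : Comp → Set _
      P α = ∀ {w w'} F → (∀ q → List⁺.length q ≤ length α → w q ≈ w' q) → expand w F α ≈ expand w' F α
      base : P []
      base {w} {w'} F _ = trans (expand-[] w F) (sym (expand-[] w' F))
      step : ∀ a t → All (P ∘ proj₂) (divisions t) → P (a ∷ t)
      step a t IH {w} {w'} F w≈w' = trans (expand-∷ w F a t) (trans (∑-congᴬ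
        (All.zipWith (λ {(u , v)} ((u≤t , v≤t) , IHv) →
            *-cong (w≈w' (a ∷ u) (ℕ.s≤s u≤t))
                   (IHv (shift (size⁺ (a ∷ u)) F) λ q q≤v →
                      w≈w' q (ℕ.≤-trans q≤v (ℕ.m≤n⇒m≤1+n v≤t))))
          (divisions-length t , IH)))
        (sym (expand-∷ w' F a t)))

  expand-linear : ∀ w α k F G → expand w (λ β → k * F β + G β) α ≈ k * expand w F α + expand w G α
  expand-linear w α k F G = begin
    ∑ (cuts α) (λ bs → ∏ bs w * (k * F (coarsening bs) + G (coarsening bs)))
      ≈⟨ ∑-cong (cuts α) (λ bs → distrib-scaled (∏ bs w) k _ _) ⟩
    ∑ (cuts α) (λ bs → k * (∏ bs w * F (coarsening bs)) + ∏ bs w * G (coarsening bs))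
      ≈⟨ ∑-+ (cuts α) _ _ ⟩
    ∑ (cuts α) (λ bs → k * (∏ bs w * F (coarsening bs))) + expand w G α
      ≈⟨ +-cong (sym (*-distribˡ-∑ k (cuts α) _)) refl ⟩
    k * expand w F α + expand w G α
      ∎
    where
      distrib-scaled : ∀ p k x y → p * (k * x + y) ≈ k * (p * x) + p * y
      distrib-scaled = solve 4 (λ p k x y → p :* (k :* x :+ y) := k :* (p :* x) :+ p :* y) refl

  δ : Comp⁺ → Carrier
  δ (a ∷ [])    = 1#
  δ (a ∷ _ ∷ _) = 0#

  expand-δ : ∀ F α → expand δ F α ≈ F α
  expand-δ F α = divisions-induction P (expand-[] δ) step α F
    where
      P : Comp → Set _
      P α = ∀ F → expand δ F α ≈ F α
      step : ∀ a t → All (P ∘ proj₂) (divisions t) → P (a ∷ t)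
      step a t IH F = trans (expand-∷ δ F a t) (first-term-only t IH)
        where
          first-term-only : ∀ t → All (P ∘ proj₂) (divisions t) →
            ∑ (divisions t) (λ (u , v) → δ (a ∷ u) * expand δ (shift (size⁺ (a ∷ u)) F) v) ≈ F (a ∷ t)
          first-term-only []      (IH[] ∷ []) = trans (+-identityʳ _) (trans (*-identityˡ _) (IH[] (shift a F)))
          first-term-only (b ∷ t) (IHt ∷ _)   = begin
            1# * expand δ (shift a F) (b ∷ t) + ∑ (map (Product.map₁ (b ∷_)) (divisions t)) term
              ≡⟨ ≡.cong (1# * expand δ (shift a F) (b ∷ t) +_) (∑-map _ (divisions t) term) ⟩
            1# * expand δ (shift a F) (b ∷ t) + ∑ (divisions t) (λ (u , v) → 0# * rest u v)
              ≈⟨ +-cong (trans (*-identityˡ _) (IHt (shift a F))) (sym (*-distribˡ-∑ 0# (divisions t) _)) ⟩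
            F (a ∷ b ∷ t) + 0# * ∑ (divisions t) (λ (u , v) → rest u v)
              ≈⟨ trans (+-cong refl (zeroˡ _)) (+-identityʳ _) ⟩
            F (a ∷ b ∷ t)
              ∎
            where
              term : Comp × Comp → Carrier
              term (u , v) = δ (a ∷ u) * expand δ (shift (size⁺ (a ∷ u)) F) v
              rest : Comp → Comp → Carrier
              rest u v = expand δ (shift (size⁺ (a ∷ b ∷ u)) F) v

  infixl 7 _⊛_

  _⊛_ : (Comp → Carrier) → (ℕ → Comp → Carrier) → Comp → Carrier
  (A ⊛ B) t = ∑ (divisions t) (λ (u , v) → A u * B (size u) v)

  ⊛-shift : ∀ A B n β → (A ⊛ B) (n ∷ β) ≡ A [] * shift n (B 0) β + (shift n A ⊛ (B ∘ (toℕ n ℕ.+_))) β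
  ⊛-shift A B n β = ≡.cong (A [] * B 0 (n ∷ β) +_) (∑-map _ (divisions β) _)

  expand-⊛ : ∀ w t A B → expand w (A ⊛ B) t ≈ (expand w A ⊛ (λ m → expand w (B m))) t
  expand-⊛ w = divisions-induction P base step
    where
      P : Comp → Set _
      P t = ∀ A B → expand w (A ⊛ B) t ≈ (expand w A ⊛ (λ m → expand w (B m))) t
      base : P []
      base A B = trans (expand-[] w (A ⊛ B))
        (+-cong (*-cong (sym (expand-[] w A)) (sym (expand-[] w (B 0)))) refl)
      step : ∀ a t → All (P ∘ proj₂) (divisions t) → P (a ∷ t)
      step a t IH A B = begin
        expand w (A ⊛ B) (a ∷ t)
          ≈⟨ expand-∷ w (A ⊛ B) a t ⟩
        ∑ (divisions t) (λ (u , v) → w (a ∷ u) * expand w (shift (n u) (A ⊛ B)) v)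
          ≈⟨ ∑-congᴬ (All.map (λ {(u , v)} IHv → *-cong refl (split u v IHv)) IH) ⟩
        ∑ (divisions t) (λ (u , v) → w (a ∷ u) * (A [] * expand w (shift (n u) (B 0)) v
                                                   + (expand w (A′ u) ⊛ E′ u) v))
          ≈⟨ ∑-cong (divisions t) (λ (u , v) → distrib-twice (w (a ∷ u)) (A []) _ _) ⟩
        ∑ (divisions t) (λ (u , v) → A [] * (w (a ∷ u) * expand w (shift (n u) (B 0)) v)
                                     + w (a ∷ u) * (expand w (A′ u) ⊛ E′ u) v)
          ≈⟨ ∑-+ (divisions t) _ _ ⟩
        ∑ (divisions t) (λ (u , v) → A [] * (w (a ∷ u) * expand w (shift (n u) (B 0)) v))
          + ∑ (divisions t) (λ (u , v) → w (a ∷ u) * (expand w (A′ u) ⊛ E′ u) v)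
          ≈⟨ +-cong (sym (*-distribˡ-∑ (A []) (divisions t) _))
                    (∑-cong (divisions t) (λ (u , v) → trans (*-distribˡ-∑ _ (divisions v) _)
                                                             (∑-cong (divisions v) (λ _ → sym (*-assoc _ _ _))))) ⟩
        A [] * ∑ (divisions t) (λ (u , v) → w (a ∷ u) * expand w (shift (n u) (B 0)) v)
          + ∑ (divisions t) (λ (u , v) → ∑ (divisions v) (λ (x , y) → G u x y))
          ≈⟨ +-cong (*-cong refl (sym (expand-∷ w (B 0) a t))) (sym (∑-divisions-assoc t G)) ⟩
        A [] * E 0 (a ∷ t) + ∑ (divisions t) (λ (U , y) → ∑ (divisions U) (λ (u , x) → G u x y))
          ≈⟨ +-cong (*-cong (sym (expand-[] w A)) refl) (∑-cong (divisions t) (λ (U , y) → sym (regroup U y))) ⟩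
        expand w A [] * E 0 (a ∷ t)
          + ∑ (divisions t) (λ (U , y) → expand w A (a ∷ U) * E (toℕ a ℕ.+ size U) y)
          ≡⟨ ≡.cong (expand w A [] * E 0 (a ∷ t) +_) (≡.sym (∑-map _ (divisions t) _)) ⟩
        (expand w A ⊛ E) (a ∷ t)
          ∎
        where
          n : Comp → ℕ⁺
          n u = size⁺ (a ∷ u)
          E : ℕ → Comp → Carrier
          E m = expand w (B m)
          A′ : Comp → Comp → Carrier
          A′ u = shift (n u) A
          E′ : Comp → ℕ → Comp → Carrier
          E′ u = E ∘ (toℕ (n u) ℕ.+_)
          G : Comp → Comp → Comp → Carrier
          G u x y = (w (a ∷ u) * expand w (A′ u) x) * E′ u (size x) y

          split : ∀ u v → P v →
            expand w (shift (n u) (A ⊛ B)) v ≈ A [] * expand w (shift (n u) (B 0)) v + (expand w (A′ u) ⊛ E′ u) v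
          split u v IHv = begin
            expand w (shift (n u) (A ⊛ B)) v
              ≈⟨ expand-cong w v (λ β → reflexive (⊛-shift A B (n u) β)) ⟩
            expand w (λ β → A [] * shift (n u) (B 0) β + (A′ u ⊛ (B ∘ (toℕ (n u) ℕ.+_))) β) v
              ≈⟨ expand-linear w v (A []) (shift (n u) (B 0)) (A′ u ⊛ (B ∘ (toℕ (n u) ℕ.+_))) ⟩
            A [] * expand w (shift (n u) (B 0)) v + expand w (A′ u ⊛ (B ∘ (toℕ (n u) ℕ.+_))) v
              ≈⟨ +-cong refl (IHv (A′ u) (B ∘ (toℕ (n u) ℕ.+_))) ⟩
            A [] * expand w (shift (n u) (B 0)) v + (expand w (A′ u) ⊛ E′ u) v
              ∎

          distrib-twice : ∀ p k x y → p * (k * x + y) ≈ k * (p * x) + p * y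
          distrib-twice = solve 4 (λ p k x y → p :* (k :* x :+ y) := k :* (p :* x) :+ p :* y) refl

          regroup : ∀ U y →
            expand w A (a ∷ U) * E (toℕ a ℕ.+ size U) y ≈ ∑ (divisions U) (λ (u , x) → G u x y)
          regroup U y = trans (*-cong (expand-∷ w A a U) refl) (trans (*-distribʳ-∑ _ (divisions U) _)
            (∑-congᴬ (All.map (λ {(u , x)} u++x≡U → *-cong refl (reflexive
              (≡.cong (λ m → E m y) (≡.trans (≡.cong (λ U → toℕ a ℕ.+ size U) (≡.sym u++x≡U))
                                            (≡.sym (toℕ-size⁺-++ a u x))))))
              (divisions-++ U))))

  -- The value at [] is never used: `expand` evaluates its argument only on coarsenings.
  extend : (Comp⁺ → Carrier) → Comp → Carrier
  extend f []      = 0#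
  extend f (a ∷ u) = f (a ∷ u)

  infixl 7 _⋆_

  _⋆_ : (Comp⁺ → Carrier) → (Comp⁺ → Carrier) → Comp⁺ → Carrier
  (g ⋆ f) q = expand g (extend f) (List⁺.toList q)

  expand-⋆ : ∀ g f α X → expand g (expand f X) α ≈ expand (g ⋆ f) X α
  expand-⋆ g f = divisions-induction P base step
    where
      P : Comp → Set _
      P α = ∀ X → expand g (expand f X) α ≈ expand (g ⋆ f) X α
      base : P []
      base X = trans (expand-[] g (expand f X)) (trans (expand-[] f X) (sym (expand-[] (g ⋆ f) X)))
      step : ∀ a t → All (P ∘ proj₂) (divisions t) → P (a ∷ t)
      step a t IH X = begin
        expand g (expand f X) (a ∷ t)
          ≈⟨ expand-∷ g (expand f X) a t ⟩
        ∑ (divisions t) (λ (u , v) → g (a ∷ u) * expand g (shift (n u) (expand f X)) v)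
          ≈⟨ ∑-cong (divisions t) (λ (u , v) → *-cong refl (trans
               (expand-cong g v (λ β → shift-expand u β))
               (expand-⊛ g v (shift (n u) (extend f)) (λ m → expand f (shift (n u ⊕ m) X))))) ⟩
        ∑ (divisions t) (λ (u , v) → g (a ∷ u) * ∑ (divisions v) (λ (x , y) →
            expand g (shift (n u) (extend f)) x * expand g (expand f (shift (n u ⊕ size x) X)) y))
          ≈⟨ ∑-cong (divisions t) (λ (u , v) → trans (*-distribˡ-∑ _ (divisions v) _)
                                                     (∑-cong (divisions v) (λ _ → sym (*-assoc _ _ _)))) ⟩
        ∑ (divisions t) (λ (u , v) → ∑ (divisions v) (λ (x , y) → H u x y))
          ≈⟨ sym (∑-divisions-assoc t H) ⟩
        ∑ (divisions t) (λ (U , y) → ∑ (divisions U) (λ (u , x) → H u x y))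
          ≈⟨ ∑-congᴬ (All.map (λ {(U , y)} IHy → sym (regroup U y IHy)) IH) ⟩
        ∑ (divisions t) (λ (U , y) → (g ⋆ f) (a ∷ U) * expand (g ⋆ f) (shift (n U) X) y)
          ≈⟨ sym (expand-∷ (g ⋆ f) X a t) ⟩
        expand (g ⋆ f) X (a ∷ t)
          ∎
        where
          n : Comp → ℕ⁺
          n u = size⁺ (a ∷ u)
          H : Comp → Comp → Comp → Carrier
          H u x y = (g (a ∷ u) * expand g (shift (n u) (extend f)) x) * expand g (expand f (shift (n u ⊕ size x) X)) y

          shift-expand : ∀ u β → shift (n u) (expand f X) β ≈
            (shift (n u) (extend f) ⊛ (λ m → expand f (shift (n u ⊕ m) X))) β
          shift-expand u β = trans (expand-∷ f X (n u) β) (∑-cong (divisions β) (λ (x , y) →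
            *-cong refl (reflexive (≡.cong (λ m → expand f (shift m X) y) (size⁺-∷-++ (n u) [] x)))))

          regroup : ∀ U y → P y →
            (g ⋆ f) (a ∷ U) * expand (g ⋆ f) (shift (n U) X) y ≈ ∑ (divisions U) (λ (u , x) → H u x y)
          regroup U y IHy = begin
            (g ⋆ f) (a ∷ U) * expand (g ⋆ f) (shift (n U) X) y
              ≈⟨ *-cong (expand-∷ g (extend f) a U) (sym (IHy (shift (n U) X))) ⟩
            ∑ (divisions U) (λ (u , x) → g (a ∷ u) * expand g (shift (n u) (extend f)) x)
              * expand g (expand f (shift (n U) X)) y
              ≈⟨ *-distribʳ-∑ _ (divisions U) _ ⟩
            ∑ (divisions U) (λ (u , x) → (g (a ∷ u) * expand g (shift (n u) (extend f)) x)
              * expand g (expand f (shift (n U) X)) y)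
              ≈⟨ ∑-congᴬ (All.map (λ {(u , x)} u++x≡U → *-cong refl (reflexive
                   (≡.cong (λ m → expand g (expand f (shift m X)) y)
                           (≡.trans (≡.cong n (≡.sym u++x≡U)) (size⁺-∷-++ a u x)))))
                 (divisions-++ U)) ⟩
            ∑ (divisions U) (λ (u , x) → H u x y)
              ∎

  module Inverse (f : Comp⁺ → Carrier) (ι : ℕ⁺ → Carrier) (fι≈1 : ∀ n → f [ n ] * ι n ≈ 1#) where

    -- The part of (w ⋆ f) q that does not involve the weight w q of the single block q.
    lower : (Comp⁺ → Carrier) → Comp⁺ → Carrier
    lower w (a ∷ α) =
      ∑ (properDivisions α) (λ (u , v) → w (a ∷ u) * expand w (shift (size⁺ (a ∷ u)) (extend f)) v)

    ⋆-lower : ∀ w q → (w ⋆ f) q ≈ lower w q + w q * f [ size⁺ q ]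
    ⋆-lower w (a ∷ α) = begin
      expand w (extend f) (a ∷ α)
        ≈⟨ expand-∷ w (extend f) a α ⟩
      ∑ (divisions α) term
        ≡⟨ ≡.cong (λ ds → ∑ ds term) (divisions-last α) ⟩
      ∑ (properDivisions α ++ (α , []) ∷ []) term
        ≈⟨ ∑-++ (properDivisions α) _ term ⟩
      lower w (a ∷ α) + (w (a ∷ α) * expand w (shift (size⁺ (a ∷ α)) (extend f)) [] + 0#)
        ≈⟨ +-cong refl (trans (+-identityʳ _) (*-cong refl (expand-[] w (shift (size⁺ (a ∷ α)) (extend f))))) ⟩
      lower w (a ∷ α) + w (a ∷ α) * f [ size⁺ (a ∷ α) ]
        ∎
      where
        term : Comp × Comp → Carrier
        term (u , v) = w (a ∷ u) * expand w (shift (size⁺ (a ∷ u)) (extend f)) v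

    lower-local : ∀ {w w'} a α → (∀ q → List⁺.length q ≤ length α → w q ≈ w' q) →
      lower w (a ∷ α) ≈ lower w' (a ∷ α)
    lower-local a α w≈w' = ∑-congᴬ (All.map (λ {(u , v)} (u<α , v≤α) →
      *-cong (w≈w' (a ∷ u) u<α)
             (expand-local v (shift (size⁺ (a ∷ u)) (extend f)) (λ q q≤v → w≈w' q (ℕ.≤-trans q≤v v≤α))))
      (properDivisions-length α))

    -- approx n agrees with the ⋆-inverse of f on compositions of length ≤ n.
    approx : ℕ → Comp⁺ → Carrier
    approx zero    q = 0#
    approx (suc n) q = ι (size⁺ q) * (δ q - lower (approx n) q)

    approx-stable : ∀ m n q → List⁺.length q ≤ m → List⁺.length q ≤ n → approx m q ≈ approx n q
    approx-stable (suc m) (suc n) (a ∷ α) (ℕ.s≤s α≤m) (ℕ.s≤s α≤n) =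
      *-cong refl (+-cong refl (-‿cong (lower-local a α (λ q q≤α →
        approx-stable m n q (ℕ.≤-trans q≤α α≤m) (ℕ.≤-trans q≤α α≤n)))))

    inverse : Comp⁺ → Carrier
    inverse q = approx (List⁺.length q) q

    inverse-⋆ : ∀ q → (inverse ⋆ f) q ≈ δ q
    inverse-⋆ (a ∷ α) = begin
      (inverse ⋆ f) (a ∷ α)
        ≈⟨ ⋆-lower inverse (a ∷ α) ⟩
      lower inverse (a ∷ α) + ι N * (δ (a ∷ α) - lower (approx (length α)) (a ∷ α)) * f [ N ]
        ≈⟨ +-cong (lower-local a α (λ q q≤α → approx-stable _ _ q ℕ.≤-refl q≤α)) refl ⟩
      L + ι N * (δ (a ∷ α) - L) * f [ N ]
        ≈⟨ +-cong refl (trans (rearrange (ι N) _ (f [ N ])) (trans (*-cong (fι≈1 N) refl) (*-identityˡ _))) ⟩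
      L + (δ (a ∷ α) - L)
        ≈⟨ trans (+-comm L _) (trans (+-assoc _ _ _) (trans (+-cong refl (-‿inverseˡ L)) (+-identityʳ _))) ⟩
      δ (a ∷ α)
        ∎
      where
        N : ℕ⁺
        N = size⁺ (a ∷ α)
        L : Carrier
        L = lower (approx (length α)) (a ∷ α)
        rearrange : ∀ i d n → i * d * n ≈ n * i * d
        rearrange = solve 3 (λ i d n → i :* d :* n := n :* i :* d) refl

    inverse-[] : ∀ n → inverse [ n ] ≈ ι n
    inverse-[] n = trans (*-cong refl (trans (+-cong refl -0#≈0#) (+-identityʳ 1#))) (*-identityʳ (ι n))
      where open import Algebra.Properties.Ring ring using (-0#≈0#)

module _ {c ℓ} (K : Field c ℓ) where
  open Field K
  open Expansion commutativeRing
  open import Relation.Binary.Reasoning.Setoid setoid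

  expansion-invertible : ∀ f (Q R : QSymFamily K) → Nonsingular K f → Expands K f Q R →
    ∃ λ g → Nonsingular K g × Expands K g R Q
  expansion-invertible f Q R f-nonsingular Q≈fR = g , g-nonsingular , R≈gQ
    where
      ι : ℕ⁺ → Carrier
      ι n = proj₁ (inverse (f [ n ]) (f-nonsingular n))
      open Inverse f ι (λ n → proj₂ (inverse (f [ n ]) (f-nonsingular n)))
        renaming (inverse to g; inverse-⋆ to g⋆f≈δ; inverse-[] to g[n]≈ι)

      g-nonsingular : Nonsingular K g
      g-nonsingular n g[n]≈0 = 1≉0 (begin
        1#             ≈⟨ sym (proj₂ (inverse (f [ n ]) (f-nonsingular n))) ⟩
        f [ n ] * ι n  ≈⟨ *-cong refl (trans (sym (g[n]≈ι n)) g[n]≈0) ⟩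
        f [ n ] * 0#   ≈⟨ zeroʳ _ ⟩
        0#             ∎)

      R≈gQ : Expands K g R Q
      R≈gQ α γ γ≡α = sym (begin
        expand g (λ β → Q β γ) α
          ≈⟨ expand-congˢ g α (λ β β≡α → Q≈fR β γ (≡.trans γ≡α (≡.sym β≡α))) ⟩
        expand g (expand f (λ β → R β γ)) α
          ≈⟨ expand-⋆ g f α (λ β → R β γ) ⟩
        expand (g ⋆ f) (λ β → R β γ) α
          ≈⟨ expand-local α (λ β → R β γ) (λ q _ → g⋆f≈δ q) ⟩
        expand δ (λ β → R β γ) α
          ≈⟨ expand-δ (λ β → R β γ) α ⟩
        R α γ
          ∎)

proposition4p4 : ∀ {c ℓ : Level} (K : Field c ℓ) (Q R : QSymFamily K) →
    IsGradedBasis K Q → IsGradedBasis K R →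
    (∃ λ f → Nonsingular K f × Expands K f Q R) ⇔
    (∃ λ g → Nonsingular K g × Expands K g R Q)
proposition4p4 K Q R _ _ = mk⇔
  (λ (f , f-nonsingular , Q≈fR) → expansion-invertible K f Q R f-nonsingular Q≈fR)
  (λ (g , g-nonsingular , R≈gQ) → expansion-invertible K g R Q g-nonsingular R≈gQ)
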